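{- Let $k>1$ be an integer. If $k$ is a perfect square, then the equation $x^2+(2k-1)^y=k^z$ has no solutions in positive integers $x,y,z$ with $y\in\{3,5\}$. -}

-- Put k = m², N = 2m² − 1 and M = mᶻ, so that a solution reads x² + Nʸ = M².
-- Exponents z ≤ y are excluded since Nʸ ≥ kʸ ≥ kᶻ. Otherwise (M − x)(M + x) = Nʸ
-- forces M < Nʸ < (2m²)ʸ, hence z ≤ 2y once m is large. For each of the finitely
-- many remaining exponents, M² − Nʸ lies strictly between P(m)² and (P(m) + 1)²
-- for an explicit polynomial P, which is checked coefficientwise in t = m − 169.
-- The finitely many cases m ≤ 168 are decided by computation.
module Submission where

open import Data.Bool using (Bool; true; false; T; _∧_; _∨_; if_then_else_)
open import Data.Bool.Properties using (T-∧; T-∨)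
open import Data.List using (List; []; _∷_)
open import Data.Nat
open import Data.Nat.Properties
open import Data.Nat.Tactic.RingSolver using (solve-∀)
open import Data.Product using (∃; _,_)
open import Data.Sum using (_⊎_; inj₁; inj₂)
open import Data.Unit using (tt)
open import Function.Bundles using (Equivalence)
open import Relation.Binary.PropositionalEquality
open import Relation.Nullary using (yes; no; contradiction)

open Equivalence using (to)

x^2≡x*x : ∀ x → x ^ 2 ≡ x * x
x^2≡x*x x = cong (x *_) (*-identityʳ x)

^-distribʳ-* : ∀ m n o → (m * n) ^ o ≡ m ^ o * n ^ o
^-distribʳ-* m n zero    = refl
^-distribʳ-* m n (suc o) rewrite ^-distribʳ-* m n o = swap-middle m n (m ^ o) (n ^ o)
  where
  swap-middle : ∀ a b c d → (a * b) * (c * d) ≡ (a * c) * (b * d)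
  swap-middle = solve-∀

x^2+V≢Q-between-squares : ∀ {p V Q} → p * p + V < Q → Q < suc p * suc p + V →
                          ∀ x → x ^ 2 + V ≢ Q
x^2+V≢Q-between-squares {p} {V} below above x eq with x ≤? p
... | yes x≤p = <-irrefl eq (≤-<-trans (+-monoˡ-≤ V x²≤p²) below)
  where x²≤p² = ≤-trans (≤-reflexive (x^2≡x*x x)) (*-mono-≤ x≤p x≤p)
... | no  x≰p = <-irrefl (sym eq) (<-≤-trans above (+-monoˡ-≤ V p+1²≤x²))
  where
  p<x = ≰⇒> x≰p
  p+1²≤x² = ≤-trans (*-mono-≤ p<x p<x) (≤-reflexive (sym (x^2≡x*x x)))

-- Writing M = x + a, the difference V = a(2x + a) exceeds M as soon as x, a ≥ 1.
x^2+V≡M*M⇒M<V : ∀ {x V M} → 0 < x → 0 < V → x ^ 2 + V ≡ M * M → M < V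
x^2+V≡M*M⇒M<V {x} {V} {M} 0<x 0<V eq with M ≤? x
... | yes M≤x = contradiction (sym eq) (<⇒≢ (begin-strict
      M * M       ≤⟨ *-mono-≤ M≤x M≤x ⟩
      x * x       ≡⟨ sym (x^2≡x*x x) ⟩
      x ^ 2       <⟨ m<m+n (x ^ 2) 0<V ⟩
      x ^ 2 + V   ∎))
  where open ≤-Reasoning
... | no  M≰x with M ∸ x | m+[n∸m]≡n (<⇒≤ (≰⇒> M≰x)) | m<n⇒0<n∸m (≰⇒> M≰x)
...   | suc a | refl | _ = begin-strict
      x + suc a                     <⟨ +-monoʳ-< x (m<n+m (suc a) 0<x) ⟩
      x + (x + suc a)               ≤⟨ m≤n*m (x + (x + suc a)) (suc a) ⟩
      suc a * (x + (x + suc a))     ≡⟨ sym V≡ ⟩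
      V                             ∎
  where
  open ≤-Reasoning
  square-of-sum : ∀ x a → (x + a) * (x + a) ≡ x * x + a * (x + (x + a))
  square-of-sum = solve-∀
  V≡ : V ≡ suc a * (x + (x + suc a))
  V≡ = +-cancelˡ-≡ (x * x) V _ (begin-equality
       x * x + V                 ≡⟨ cong (_+ V) (sym (x^2≡x*x x)) ⟩
       x ^ 2 + V                 ≡⟨ eq ⟩
       (x + suc a) * (x + suc a) ≡⟨ square-of-sum x (suc a) ⟩
       x * x + suc a * (x + (x + suc a)) ∎)

k≤2*k∸1 : ∀ {k} → 1 ≤ k → k ≤ 2 * k ∸ 1
k≤2*k∸1 {suc k} _ rewrite +-suc k (k + 0) = s≤s (m≤m+n k (k + 0))

-- Newton's iteration for ⌊√n⌋; its result is only used as a candidate, so no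
-- correctness proof is needed.
isqrt-from : (fuel n x : ℕ) → ℕ
isqrt-from zero    n x       = x
isqrt-from (suc f) n zero    = zero
isqrt-from (suc f) n (suc x) =
  let x′ = (suc x + n / suc x) / 2 in
  if x′ <ᵇ suc x then isqrt-from f n x′ else suc x

isqrt : ℕ → ℕ
isqrt n = isqrt-from 200 n n

squeezedᵇ : (p V Q : ℕ) → Bool
squeezedᵇ p V Q = (p * p + V <ᵇ Q) ∧ (Q <ᵇ suc p * suc p + V)

noPositiveRootᵇ : (V Q : ℕ) → Bool
noPositiveRootᵇ V Q = (Q ≤ᵇ V) ∨ squeezedᵇ (isqrt (Q ∸ V)) V Q

noPositiveRootᵇ-sound : ∀ {V Q} → T (noPositiveRootᵇ V Q) → ∀ x → 0 < x → x ^ 2 + V ≢ Q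
noPositiveRootᵇ-sound {V} {Q} h x 0<x with to (T-∨ {Q ≤ᵇ V}) h
... | inj₁ Q≤V = λ eq → <-irrefl (sym eq) (≤-<-trans (≤ᵇ⇒≤ Q V Q≤V) (m<n+m V (m^n>0 x {{>-nonZero 0<x}} 2)))
... | inj₂ h′ with to (T-∧ {_ <ᵇ Q}) h′
...   | below , above = x^2+V≢Q-between-squares {isqrt (Q ∸ V)} (<ᵇ⇒< _ _ below) (<ᵇ⇒< _ _ above) x

allUpToᵇ : (ℕ → Bool) → ℕ → Bool
allUpToᵇ P zero    = true
allUpToᵇ P (suc n) = P (suc n) ∧ allUpToᵇ P n

allUpToᵇ-sound : ∀ P {n} → T (allUpToᵇ P n) → ∀ {m} → 1 ≤ m → m ≤ n → T (P m)
allUpToᵇ-sound P {zero} _ (s≤s _) ()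
allUpToᵇ-sound P {suc n} h {m} 1≤m m≤1+n with to (T-∧ {P (suc n)}) h | m ≟ suc n
... | here , _    | yes refl  = here
... | _    , rest | no  m≢1+n = allUpToᵇ-sound P rest 1≤m (≤-pred (≤∧≢⇒< m≤1+n m≢1+n))

-- Coefficient lists, constant term first. Since t ≥ 0, comparing coefficients
-- suffices to compare values.
Poly : Set
Poly = List ℕ

⟦_⟧ : Poly → ℕ → ℕ
⟦ []    ⟧ t = 0
⟦ c ∷ p ⟧ t = c + t * ⟦ p ⟧ t

infixl 6 _⊕_
infixl 7 _⊗_

_⊕_ : Poly → Poly → Poly
[]      ⊕ q       = q
(c ∷ p) ⊕ []      = c ∷ p
(c ∷ p) ⊕ (d ∷ q) = c + d ∷ p ⊕ q

scale : ℕ → Poly → Poly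
scale c []      = []
scale c (d ∷ p) = c * d ∷ scale c p

_⊗_ : Poly → Poly → Poly
[]      ⊗ q = []
(c ∷ p) ⊗ q = scale c q ⊕ (0 ∷ p ⊗ q)

_⊗^_ : Poly → ℕ → Poly
p ⊗^ zero  = 1 ∷ []
p ⊗^ suc n = p ⊗^ n ⊗ p

⊕-homo : ∀ p q t → ⟦ p ⊕ q ⟧ t ≡ ⟦ p ⟧ t + ⟦ q ⟧ t
⊕-homo []      q       t = refl
⊕-homo (c ∷ p) []      t = sym (+-identityʳ _)
⊕-homo (c ∷ p) (d ∷ q) t rewrite ⊕-homo p q t = shuffle c d t (⟦ p ⟧ t) (⟦ q ⟧ t)
  where
  shuffle : ∀ c d t a b → c + d + t * (a + b) ≡ c + t * a + (d + t * b)
  shuffle = solve-∀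

scale-homo : ∀ c p t → ⟦ scale c p ⟧ t ≡ c * ⟦ p ⟧ t
scale-homo c []      t = sym (*-zeroʳ c)
scale-homo c (d ∷ p) t rewrite scale-homo c p t = factor c d t (⟦ p ⟧ t)
  where
  factor : ∀ c d t a → c * d + t * (c * a) ≡ c * (d + t * a)
  factor = solve-∀

⊗-homo : ∀ p q t → ⟦ p ⊗ q ⟧ t ≡ ⟦ p ⟧ t * ⟦ q ⟧ t
⊗-homo []      q t = refl
⊗-homo (c ∷ p) q t
  rewrite ⊕-homo (scale c q) (0 ∷ p ⊗ q) t | scale-homo c q t | ⊗-homo p q t
  = distrib c (⟦ q ⟧ t) t (⟦ p ⟧ t)
  where
  distrib : ∀ c b t a → c * b + (0 + t * (a * b)) ≡ (c + t * a) * b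
  distrib = solve-∀

⊗^-homo : ∀ p n t → ⟦ p ⊗^ n ⟧ t ≡ ⟦ p ⟧ t ^ n
⊗^-homo p zero    t rewrite *-zeroʳ t = refl
⊗^-homo p (suc n) t rewrite ⊗-homo (p ⊗^ n) p t | ⊗^-homo p n t = *-comm (⟦ p ⟧ t ^ n) (⟦ p ⟧ t)

_≤ᶜᵇ_ : Poly → Poly → Bool
[]      ≤ᶜᵇ q       = true
(c ∷ p) ≤ᶜᵇ []      = (c ≤ᵇ 0) ∧ (p ≤ᶜᵇ [])
(c ∷ p) ≤ᶜᵇ (d ∷ q) = (c ≤ᵇ d) ∧ (p ≤ᶜᵇ q)

≤ᶜᵇ⇒≤ : ∀ p q → T (p ≤ᶜᵇ q) → ∀ t → ⟦ p ⟧ t ≤ ⟦ q ⟧ t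
≤ᶜᵇ⇒≤ []      q       _ t = z≤n
≤ᶜᵇ⇒≤ (c ∷ p) []      h t with to (T-∧ {c ≤ᵇ 0}) h
... | c≤0 , p≤0 with ≤ᵇ⇒≤ c 0 c≤0
...   | z≤n = ≤-trans (*-monoʳ-≤ t (≤ᶜᵇ⇒≤ p [] p≤0 t)) (≤-reflexive (*-zeroʳ t))
≤ᶜᵇ⇒≤ (c ∷ p) (d ∷ q) h t with to (T-∧ {c ≤ᵇ d}) h
... | c≤d , p≤q = +-mono-≤ (≤ᵇ⇒≤ c d c≤d) (*-monoʳ-≤ t (≤ᶜᵇ⇒≤ p q p≤q t))

infixl 6 _:+_
infixl 7 _:*_
infixr 8 _:^_

data Expr : Set where
  var  : Expr
  con  : ℕ → Expr
  poly : Poly → Expr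
  _:+_ : Expr → Expr → Expr
  _:*_ : Expr → Expr → Expr
  _:^_ : Expr → ℕ → Expr

⟦_⟧ₑ : Expr → ℕ → ℕ
⟦ var    ⟧ₑ t = t
⟦ con c  ⟧ₑ t = c
⟦ poly p ⟧ₑ t = ⟦ p ⟧ t
⟦ a :+ b ⟧ₑ t = ⟦ a ⟧ₑ t + ⟦ b ⟧ₑ t
⟦ a :* b ⟧ₑ t = ⟦ a ⟧ₑ t * ⟦ b ⟧ₑ t
⟦ a :^ n ⟧ₑ t = ⟦ a ⟧ₑ t ^ n

normalise : Expr → Poly
normalise var      = 0 ∷ 1 ∷ []
normalise (con c)  = c ∷ []
normalise (poly p) = p
normalise (a :+ b) = normalise a ⊕ normalise b
normalise (a :* b) = normalise a ⊗ normalise b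
normalise (a :^ n) = normalise a ⊗^ n

normalise-sound : ∀ e t → ⟦ e ⟧ₑ t ≡ ⟦ normalise e ⟧ t
normalise-sound var      t rewrite *-zeroʳ t | *-identityʳ t = refl
normalise-sound (con c)  t rewrite *-zeroʳ t | +-identityʳ c = refl
normalise-sound (poly p) t = refl
normalise-sound (a :+ b) t
  rewrite ⊕-homo (normalise a) (normalise b) t | normalise-sound a t | normalise-sound b t = refl
normalise-sound (a :* b) t
  rewrite ⊗-homo (normalise a) (normalise b) t | normalise-sound a t | normalise-sound b t = refl
normalise-sound (a :^ n) t rewrite ⊗^-homo (normalise a) n t | normalise-sound a t = refl

≡-by-normalise : ∀ e₁ e₂ → normalise e₁ ≡ normalise e₂ → ∀ t → ⟦ e₁ ⟧ₑ t ≡ ⟦ e₂ ⟧ₑ t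
≡-by-normalise e₁ e₂ eq t =
  trans (normalise-sound e₁ t) (trans (cong (λ p → ⟦ p ⟧ t) eq) (sym (normalise-sound e₂ t)))

≤-by-coefficients : ∀ e₁ e₂ → T (normalise e₁ ≤ᶜᵇ normalise e₂) → ∀ t → ⟦ e₁ ⟧ₑ t ≤ ⟦ e₂ ⟧ₑ t
≤-by-coefficients e₁ e₂ h t = subst₂ _≤_ (sym (normalise-sound e₁ t)) (sym (normalise-sound e₂ t))
  (≤ᶜᵇ⇒≤ (normalise e₁) (normalise e₂) h t)

N : ℕ → ℕ
N m = 2 * (m * m) ∸ 1

0<N^y : ∀ {m} → 1 ≤ m → ∀ y → 0 < N m ^ y
0<N^y 1≤m y = m^n>0 _ {{>-nonZero (≤-trans 1≤m*m (k≤2*k∸1 1≤m*m))}} y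
  where 1≤m*m = *-mono-≤ 1≤m 1≤m

m^z<N^y : ∀ {m y z x} → 1 ≤ m → 0 < x → x ^ 2 + N m ^ y ≡ (m * m) ^ z → m ^ z < N m ^ y
m^z<N^y {m} {y} {z} 1≤m 0<x eq =
  x^2+V≡M*M⇒M<V 0<x (0<N^y 1≤m y) (trans eq (^-distribʳ-* m m z))

no-solution-z≤y : ∀ {m y z} → 1 ≤ m → z ≤ y → ∀ x → 0 < x → x ^ 2 + N m ^ y ≢ (m * m) ^ z
no-solution-z≤y {m} {y} {z} 1≤m z≤y x@(suc _) _ eq = <-irrefl (sym eq) (begin-strict
  (m * m) ^ z        ≤⟨ ^-monoʳ-≤ (m * m) {{>-nonZero 1≤m*m}} z≤y ⟩
  (m * m) ^ y        ≤⟨ ^-monoˡ-≤ y (k≤2*k∸1 1≤m*m) ⟩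
  N m ^ y            <⟨ m<n+m _ z<s ⟩
  x ^ 2 + N m ^ y    ∎)
  where
  open ≤-Reasoning
  1≤m*m = *-mono-≤ 1≤m 1≤m

-- Stops at the first z with Nʸ ≤ mᶻ: by m^z<N^y, no larger exponent gives a solution.
noSolutionFromᵇ : (fuel m y z : ℕ) → Bool
noSolutionFromᵇ zero    m y z = false
noSolutionFromᵇ (suc f) m y z =
  (N m ^ y ≤ᵇ m ^ z) ∨ (noPositiveRootᵇ (N m ^ y) ((m * m) ^ z) ∧ noSolutionFromᵇ f m y (suc z))

noSolutionFromᵇ-sound : ∀ f {m y z} → 1 ≤ m → T (noSolutionFromᵇ f m y z) →
                        ∀ {z′} → z ≤ z′ → ∀ x → 0 < x → x ^ 2 + N m ^ y ≢ (m * m) ^ z′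
noSolutionFromᵇ-sound (suc f) {m} {y} {z} 1≤m h {z′} z≤z′ x 0<x eq with to (T-∨ {N m ^ y ≤ᵇ m ^ z}) h
... | inj₁ Nʸ≤mᶻ = <-irrefl refl (<-≤-trans (m^z<N^y {m} {y} {z′} 1≤m 0<x eq)
                     (≤-trans (≤ᵇ⇒≤ _ _ Nʸ≤mᶻ) (^-monoʳ-≤ m {{>-nonZero 1≤m}} z≤z′)))
... | inj₂ h′ with to (T-∧ {noPositiveRootᵇ (N m ^ y) ((m * m) ^ z)}) h′
...   | here , later with z ≟ z′
...     | yes refl = noPositiveRootᵇ-sound {N m ^ y} {(m * m) ^ z} here x 0<x eq
...     | no  z≢z′ = noSolutionFromᵇ-sound f 1≤m later (≤∧≢⇒< z≤z′ z≢z′) x 0<x eq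

no-solution-m≤168 : ∀ {m y} → y ≡ 3 ⊎ y ≡ 5 → 1 ≤ m → m ≤ 168 →
                    ∀ z x → 0 < x → x ^ 2 + N m ^ y ≢ (m * m) ^ z
no-solution-m≤168 {m} {y} y∈ 1≤m m≤168 z =
  noSolutionFromᵇ-sound 64 {m} {y} {0} 1≤m
    (allUpToᵇ-sound (λ m → noSolutionFromᵇ 64 m y 0) {168} (checked y∈) 1≤m m≤168) {z} z≤n
  where
  checked : ∀ {y} → y ≡ 3 ⊎ y ≡ 5 → T (allUpToᵇ (λ m → noSolutionFromᵇ 64 m y 0) 168)
  checked (inj₁ refl) = tt
  checked (inj₂ refl) = tt

mₑ kₑ Nₑ : Expr
mₑ = con 169 :+ var
kₑ = mₑ :* mₑ
Nₑ = poly (57121 ∷ 676 ∷ 2 ∷ [])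

N[169+t]≡Nₑ : ∀ t → N (169 + t) ≡ ⟦ Nₑ ⟧ₑ t
N[169+t]≡Nₑ t = cong (_∸ 1) (≡-by-normalise (con 2 :* kₑ) (con 1 :+ Nₑ) refl t)

no-solution-squeezed : ∀ y z P →
  T (normalise (con 1 :+ (poly P :* poly P :+ Nₑ :^ y)) ≤ᶜᵇ normalise (kₑ :^ z)) →
  T (normalise (con 1 :+ kₑ :^ z) ≤ᶜᵇ normalise ((con 1 :+ poly P) :* (con 1 :+ poly P) :+ Nₑ :^ y)) →
  ∀ t x → x ^ 2 + N (169 + t) ^ y ≢ ((169 + t) * (169 + t)) ^ z
no-solution-squeezed y z P below above t x =
  subst (λ N → x ^ 2 + N ^ y ≢ ((169 + t) * (169 + t)) ^ z) (sym (N[169+t]≡Nₑ t))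
    (x^2+V≢Q-between-squares {⟦ P ⟧ t} {⟦ Nₑ ⟧ₑ t ^ y} {((169 + t) * (169 + t)) ^ z}
      (≤-by-coefficients (con 1 :+ (poly P :* poly P :+ Nₑ :^ y)) (kₑ :^ z) below t)
      (≤-by-coefficients (con 1 :+ kₑ :^ z) ((con 1 :+ poly P) :* (con 1 :+ poly P) :+ Nₑ :^ y) above t) x)

no-solution-z>2y : ∀ y z → 2 * y + 1 ≤ z → T (normalise (Nₑ :^ y) ≤ᶜᵇ normalise (mₑ :^ (2 * y + 1))) →
  ∀ t x → 0 < x → x ^ 2 + N (169 + t) ^ y ≢ ((169 + t) * (169 + t)) ^ z
no-solution-z>2y y z 2y+1≤z Nʸ≤m²ʸ⁺¹ t x 0<x eq = <-irrefl refl (begin-strict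
  m ^ z              <⟨ m^z<N^y {m} {y} {z} (s≤s z≤n) 0<x eq ⟩
  N m ^ y            ≡⟨ cong (_^ y) (N[169+t]≡Nₑ t) ⟩
  ⟦ Nₑ ⟧ₑ t ^ y      ≤⟨ ≤-by-coefficients (Nₑ :^ y) (mₑ :^ (2 * y + 1)) Nʸ≤m²ʸ⁺¹ t ⟩
  m ^ (2 * y + 1)    ≤⟨ ^-monoʳ-≤ m 2y+1≤z ⟩
  m ^ z              ∎)
  where
  open ≤-Reasoning
  m = 169 + t

-- root-y-z t = ⌊√(m^2z − Nʸ)⌋ for every m = 169 + t.
root-3-4 root-3-5 root-3-6 root-5-6 root-5-7 root-5-8 root-5-9 root-5-10 : Poly
root-3-4 = 815616474 ∷ 19305884 ∷ 171362 ∷ 676 ∷ 1 ∷ []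
root-3-5 = 137858491173 ∷ 4078653601 ∷ 48268090 ∷ 285610 ∷ 845 ∷ 1 ∷ []
root-3-6 = 23298085122477 ∷ 827150951094 ∷ 12235960815 ∷ 96536180 ∷ 428415 ∷ 1014 ∷ 1 ∷ []
root-5-6 = 23285030916128 ∷ 826842005574 ∷ 12233218871 ∷ 96525364 ∷ 428399 ∷ 1014 ∷ 1 ∷ []
root-5-7 = 3937376308477104 ∷ 163086594486479 ∷ 2895028320717 ∷ 28550575219 ∷ 168938315 ∷
           599781 ∷ 1183 ∷ 1 ∷ []
root-5-8 = 665416609182722904 ∷ 31499011085588904 ∷ 652346383429452 ∷ 7720075543544 ∷
           57101150470 ∷ 270301304 ∷ 799708 ∷ 1352 ∷ 1 ∷ []
root-5-9 = 112455406951957390425 ∷ 5988749482648618553 ∷ 141745549885174404 ∷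
           1957039150288404 ∷ 17370169972974 ∷ 102782070846 ∷ 405451956 ∷ 1028196 ∷ 1521 ∷ 1 ∷ []
root-5-10 = 19004963774880799438785 ∷ 1124554069519573931290 ∷ 29943747413243092845 ∷
            472485166283914680 ∷ 4892597875721010 ∷ 34740339945948 ∷ 171303451410 ∷ 579217080 ∷
            1285245 ∷ 1690 ∷ 1 ∷ []

no-solution-y≡3-m≥169 : ∀ t z x → 0 < x → x ^ 2 + N (169 + t) ^ 3 ≢ ((169 + t) * (169 + t)) ^ z
no-solution-y≡3-m≥169 t 0 = no-solution-z≤y {169 + t} (s≤s z≤n) (≤ᵇ⇒≤ 0 3 tt)
no-solution-y≡3-m≥169 t 1 = no-solution-z≤y {169 + t} (s≤s z≤n) (≤ᵇ⇒≤ 1 3 tt)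
no-solution-y≡3-m≥169 t 2 = no-solution-z≤y {169 + t} (s≤s z≤n) (≤ᵇ⇒≤ 2 3 tt)
no-solution-y≡3-m≥169 t 3 = no-solution-z≤y {169 + t} (s≤s z≤n) (≤ᵇ⇒≤ 3 3 tt)
no-solution-y≡3-m≥169 t 4 x _ = no-solution-squeezed 3 4 root-3-4 tt tt t x
no-solution-y≡3-m≥169 t 5 x _ = no-solution-squeezed 3 5 root-3-5 tt tt t x
no-solution-y≡3-m≥169 t 6 x _ = no-solution-squeezed 3 6 root-3-6 tt tt t x
no-solution-y≡3-m≥169 t z@(suc (suc (suc (suc (suc (suc (suc w))))))) =
  no-solution-z>2y 3 z (m≤m+n 7 w) tt t

no-solution-y≡5-m≥169 : ∀ t z x → 0 < x → x ^ 2 + N (169 + t) ^ 5 ≢ ((169 + t) * (169 + t)) ^ z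
no-solution-y≡5-m≥169 t 0 = no-solution-z≤y {169 + t} (s≤s z≤n) (≤ᵇ⇒≤ 0 5 tt)
no-solution-y≡5-m≥169 t 1 = no-solution-z≤y {169 + t} (s≤s z≤n) (≤ᵇ⇒≤ 1 5 tt)
no-solution-y≡5-m≥169 t 2 = no-solution-z≤y {169 + t} (s≤s z≤n) (≤ᵇ⇒≤ 2 5 tt)
no-solution-y≡5-m≥169 t 3 = no-solution-z≤y {169 + t} (s≤s z≤n) (≤ᵇ⇒≤ 3 5 tt)
no-solution-y≡5-m≥169 t 4 = no-solution-z≤y {169 + t} (s≤s z≤n) (≤ᵇ⇒≤ 4 5 tt)
no-solution-y≡5-m≥169 t 5 = no-solution-z≤y {169 + t} (s≤s z≤n) (≤ᵇ⇒≤ 5 5 tt)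
no-solution-y≡5-m≥169 t 6 x _ = no-solution-squeezed 5 6 root-5-6 tt tt t x
no-solution-y≡5-m≥169 t 7 x _ = no-solution-squeezed 5 7 root-5-7 tt tt t x
no-solution-y≡5-m≥169 t 8 x _ = no-solution-squeezed 5 8 root-5-8 tt tt t x
no-solution-y≡5-m≥169 t 9 x _ = no-solution-squeezed 5 9 root-5-9 tt tt t x
no-solution-y≡5-m≥169 t 10 x _ = no-solution-squeezed 5 10 root-5-10 tt tt t x
no-solution-y≡5-m≥169 t z@(suc (suc (suc (suc (suc (suc (suc (suc (suc (suc (suc w))))))))))) =
  no-solution-z>2y 5 z (m≤m+n 11 w) tt t

no-solution : ∀ {m y} → y ≡ 3 ⊎ y ≡ 5 → 1 ≤ m → ∀ z x → 0 < x → x ^ 2 + N m ^ y ≢ (m * m) ^ z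
no-solution {m} {y} y∈ 1≤m z x 0<x with m ≤? 168
... | yes m≤168 = no-solution-m≤168 y∈ 1≤m m≤168 z x 0<x
... | no  m≰168 = subst (λ m → x ^ 2 + N m ^ y ≢ (m * m) ^ z) (m+[n∸m]≡n (≰⇒> m≰168))
                    (m≥169 y∈ (m ∸ 169) z x 0<x)
  where
  m≥169 : ∀ {y} → y ≡ 3 ⊎ y ≡ 5 → ∀ t z x → 0 < x → x ^ 2 + N (169 + t) ^ y ≢ ((169 + t) * (169 + t)) ^ z
  m≥169 (inj₁ refl) = no-solution-y≡3-m≥169
  m≥169 (inj₂ refl) = no-solution-y≡5-m≥169

theorem1p2 : (k : ℕ) → 1 < k → ∃ (λ m → k ≡ m * m) →
    (x y z : ℕ) → 0 < x → 0 < y → 0 < z → (y ≡ 3 ⊎ y ≡ 5) →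
    x ^ 2 + (2 * k ∸ 1) ^ y ≢ k ^ z
theorem1p2 .(0 * 0)         ()  (zero  , refl)
theorem1p2 .(suc m * suc m) _ (suc m , refl) x y z 0<x _ _ y∈ = no-solution {suc m} y∈ (s≤s z≤n) z x 0<x
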